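{- Let $n\ge3$, let $H$ be a finite abelian group of order $2n^2+1$ and let $T\subseteq H$ satisfy $|T|=2n$, $T=T^{(-1)}$ and $T^2=2H-T^{(2)}+(2n-2)e$ in $\mathbb{Z}[H]$. Then $\chi(T)\neq 0$ for every nontrivial character $\chi$ of $H$.
   Context: $H$ is written multiplicatively with identity $e$. In the group ring $\mathbb{Z}[H]$ a subset $A$ is identified with $\sum_{g\in A}g$ (so $H$ is the sum of all elements), and $A^{(t)}=\sum a_g g^t$ for $A=\sum a_g g$. For a character $\chi$ of $H$, $\chi(\sum a_g g)=\sum a_g\chi(g)$. -}

module Defs where

open import Level using (Level; _⊔_) renaming (suc to lsuc)
open import Data.Nat using (ℕ; zero; suc)
open import Data.Integer as ℤ using (ℤ; +_; -[1+_])
open import Data.Fin using (Fin; zero; suc)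
import Data.Fin.Properties as FinP
open import Data.Bool using (Bool; true; false; if_then_else_)
open import Data.Product using (Σ; _,_)
open import Relation.Binary.PropositionalEquality using (_≡_; refl; cong; sym; trans)
open import Relation.Nullary using (Dec; yes; no; ¬_)
open import Relation.Nullary.Decidable using (map′)
open import Function.Bundles using (_↔_; Inverse)
open import Algebra.Structures using (IsAbelianGroup)
open import Algebra.Bundles using (CommutativeRing)

record FinAbGroup : Set₁ where
  infixl 7 _∙_
  field
    Carrier        : Set
    _∙_            : Carrier → Carrier → Carrier
    e              : Carrier
    _⁻¹            : Carrier → Carrier
    isAbelianGroup : IsAbelianGroup _≡_ _∙_ e _⁻¹
    order          : ℕ
    enum           : Carrier ↔ Fin order

  open Inverse enum using (to; from; strictlyInverseʳ)

  to-injective : ∀ {g h} → to g ≡ to h → g ≡ h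
  to-injective {g} {h} p = trans (sym (strictlyInverseʳ g)) (trans (cong from p) (strictlyInverseʳ h))

  _≟_ : (g h : Carrier) → Dec (g ≡ h)
  g ≟ h = map′ to-injective (cong to) (to g FinP.≟ to h)

  sumFin : ∀ {a} {A : Set a} → (A → A → A) → A → (m : ℕ) → (Fin m → A) → A
  sumFin _+_ z zero    f = z
  sumFin _+_ z (suc m) f = f zero + sumFin _+_ z m (λ i → f (suc i))

  ΣH : ∀ {a} {A : Set a} → (A → A → A) → A → (Carrier → A) → A
  ΣH _+_ z f = sumFin _+_ z order (λ i → f (from i))

  ZH : Set
  ZH = Carrier → ℤ

  _≐_ : ZH → ZH → Set
  A ≐ B = ∀ g → A g ≡ B g

  _⊛_ : ZH → ZH → ZH
  (A ⊛ B) g = ΣH ℤ._+_ (+ 0) (λ h → A h ℤ.* B ((h ⁻¹) ∙ g))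

  _⊕_ : ZH → ZH → ZH
  (A ⊕ B) g = A g ℤ.+ B g

  ⊖_ : ZH → ZH
  (⊖ A) g = ℤ.- A g

  _·_ : ℤ → ZH → ZH
  (c · A) g = c ℤ.* A g

  eZ : ZH
  eZ g = if Relation.Nullary.Dec.does (g ≟ e) then + 1 else + 0

  HZ : ZH
  HZ g = + 1

  inv⁽⁻¹⁾ : ZH → ZH
  inv⁽⁻¹⁾ A g = A (g ⁻¹)

  sq⁽²⁾ : ZH → ZH
  sq⁽²⁾ A x = ΣH ℤ._+_ (+ 0)
                (λ g → if Relation.Nullary.Dec.does ((g ∙ g) ≟ x) then A g else + 0)

  Subset : Set
  Subset = Carrier → Bool

  ⟦_⟧ : Subset → ZH
  ⟦ T ⟧ g = if T g then + 1 else + 0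

  ∣_∣ : Subset → ℕ
  ∣ T ∣ = ΣH Data.Nat._+_ 0 (λ g → if T g then 1 else 0)

-- Commutative rings in which (a copy of) the character values live:
-- integral domains of characteristic zero (stand-in for ℂ).
module _ {c ℓ} (R : CommutativeRing c ℓ) where
  open CommutativeRing R

  ℕ→R : ℕ → Carrier
  ℕ→R zero    = 0#
  ℕ→R (suc k) = 1# + ℕ→R k

  ℤ→R : ℤ → Carrier
  ℤ→R (+ k)      = ℕ→R k
  ℤ→R -[1+ k ]   = - ℕ→R (suc k)

  CharZero : Set ℓ
  CharZero = ∀ k → ℕ→R k ≈ 0# → k ≡ 0

  IntegralDomain : Set (c ⊔ ℓ)
  IntegralDomain = ∀ x y → x * y ≈ 0# → Data.Sum._⊎_ (x ≈ 0#) (y ≈ 0#)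
    where import Data.Sum

module _ (H : FinAbGroup) {c ℓ} (R : CommutativeRing c ℓ) where
  open FinAbGroup H
  private module R = CommutativeRing R

  record Character : Set (c ⊔ ℓ) where
    field
      χ      : Carrier → R.Carrier
      χ-e    : χ e R.≈ R.1#
      χ-hom  : ∀ g h → χ (g ∙ h) R.≈ (χ g R.* χ h)

  Nontrivial : Character → Set ℓ
  Nontrivial X = Σ Carrier (λ g → ¬ (Character.χ X g R.≈ R.1#))

  evalχ : Character → ZH → R.Carrier
  evalχ X A = ΣH R._+_ R.0# (λ g → ℤ→R R (A g) R.* Character.χ X g)

{-# OPTIONS --safe #-}
module Submission where

-- Suppose χ(T) = 0 for a nontrivial character χ.  Since |H| is odd, every χ^(2^k) is again
-- nontrivial, so it kills H, and evaluating T² = 2H − T^(2) + m·e at χ^(2^k) gives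
-- χ^(2^(k+1))(T) = m − χ^(2^k)(T)² with m = 2n − 2 ≥ 4.  Hence the values χ^(2^k)(T) are the
-- integers y₀ = 0, y_{k+1} = m − y_k², whose absolute values strictly increase.  But χ^(2^k)
-- only depends on 2^k mod |H|, so two of these values coincide.

open import Defs
open import Level using (_⊔_)
open import Algebra.Bundles using (CommutativeRing; CommutativeMonoid; Group)
open import Algebra.Structures using (IsAbelianGroup)
open import Data.Bool using (if_then_else_)
open import Data.Empty using (⊥-elim)
open import Data.Fin using (Fin; zero; suc; toℕ; punchIn)
open import Data.Fin.Properties using (nonZeroIndex; pigeonhole; toℕ-fromℕ<; punchInᵢ≢i)
open import Data.Integer as ℤ using (ℤ; +_; -[1+_]; _⊖_; ∣_∣; sign; _◃_)
import Data.Integer.Properties as ℤ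
open import Data.Nat as ℕ using (ℕ; zero; suc; _≤_; _<_; s≤s; z≤n)
import Data.Nat.Properties as ℕ
open import Data.Nat.DivMod using (_mod_; _%_; _/_; m≡m%n+[m/n]*n)
open import Data.Product using (_,_; ∃₂)
open import Data.Sign as Sign using (Sign)
open import Data.Sum using (inj₁; inj₂)
open import Data.Vec.Functional using (replicate)
open import Function.Base using (_∘_)
open import Function.Bundles using (Inverse; mk↔ₛ′)
open import Relation.Binary.PropositionalEquality as ≡ using (_≡_; _≢_)
open import Relation.Nullary using (¬_; does)
open import Relation.Nullary.Decidable using (dec-true; dec-false)

module IntegerEmbedding {c ℓ} (R : CommutativeRing c ℓ) where
  open CommutativeRing R
  open import Algebra.Properties.Ring ring
    using (-0#≈0#; -‿involutive; -1*x≈-x; -‿+-comm; x≈y⇒x∙y⁻¹≈ε)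
  open import Algebra.Properties.CommutativeSemigroup +-commutativeSemigroup using () renaming (interchange to +-interchange)
  open import Algebra.Properties.CommutativeSemigroup *-commutativeSemigroup using () renaming (interchange to *-interchange)
  open import Algebra.Properties.Semiring.Mult semiring using (_×_; ×-homo-+; ×1-homo-*)
  open import Relation.Binary.Reasoning.Setoid setoid

  ℕ→R≈×1# : ∀ k → ℕ→R R k ≈ k × 1#
  ℕ→R≈×1# zero    = refl
  ℕ→R≈×1# (suc k) = +-congˡ (ℕ→R≈×1# k)

  ℕ→R-homo-+ : ∀ a b → ℕ→R R (a ℕ.+ b) ≈ ℕ→R R a + ℕ→R R b
  ℕ→R-homo-+ a b = begin
    ℕ→R R (a ℕ.+ b)         ≈⟨ ℕ→R≈×1# (a ℕ.+ b) ⟩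
    (a ℕ.+ b) × 1#          ≈⟨ ×-homo-+ 1# a b ⟩
    a × 1# + b × 1#         ≈⟨ +-cong (ℕ→R≈×1# a) (ℕ→R≈×1# b) ⟨
    ℕ→R R a + ℕ→R R b       ∎

  ℕ→R-homo-* : ∀ a b → ℕ→R R (a ℕ.* b) ≈ ℕ→R R a * ℕ→R R b
  ℕ→R-homo-* a b = begin
    ℕ→R R (a ℕ.* b)         ≈⟨ ℕ→R≈×1# (a ℕ.* b) ⟩
    (a ℕ.* b) × 1#          ≈⟨ ×1-homo-* a b ⟩
    a × 1# * b × 1#         ≈⟨ *-cong (ℕ→R≈×1# a) (ℕ→R≈×1# b) ⟨
    ℕ→R R a * ℕ→R R b       ∎

  Sign→R : Sign → Carrier
  Sign→R Sign.+ = 1#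
  Sign→R Sign.- = - 1#

  Sign→R-homo-* : ∀ s t → Sign→R (s Sign.* t) ≈ Sign→R s * Sign→R t
  Sign→R-homo-* Sign.+ t      = sym (*-identityˡ _)
  Sign→R-homo-* Sign.- Sign.+ = sym (*-identityʳ _)
  Sign→R-homo-* Sign.- Sign.- = sym (trans (-1*x≈-x _) (-‿involutive _))

  ℤ→R-◃ : ∀ s k → ℤ→R R (s ◃ k) ≈ Sign→R s * ℕ→R R k
  ℤ→R-◃ s      zero    = sym (zeroʳ _)
  ℤ→R-◃ Sign.+ (suc k) = sym (*-identityˡ _)
  ℤ→R-◃ Sign.- (suc k) = sym (-1*x≈-x _)

  ℤ→R-sign-abs : ∀ i → ℤ→R R i ≈ Sign→R (sign i) * ℕ→R R ∣ i ∣
  ℤ→R-sign-abs (+ k)    = sym (*-identityˡ _)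
  ℤ→R-sign-abs -[1+ k ] = sym (-1*x≈-x _)

  ℤ→R-homo-* : ∀ i j → ℤ→R R (i ℤ.* j) ≈ ℤ→R R i * ℤ→R R j
  ℤ→R-homo-* i j = begin
    ℤ→R R (s Sign.* t ◃ a ℕ.* b)                 ≈⟨ ℤ→R-◃ (s Sign.* t) (a ℕ.* b) ⟩
    Sign→R (s Sign.* t) * ℕ→R R (a ℕ.* b)         ≈⟨ *-cong (Sign→R-homo-* s t) (ℕ→R-homo-* a b) ⟩
    (Sign→R s * Sign→R t) * (ℕ→R R a * ℕ→R R b)
      ≈⟨ *-interchange _ _ _ _ ⟩
    (Sign→R s * ℕ→R R a) * (Sign→R t * ℕ→R R b)    ≈⟨ *-cong (ℤ→R-sign-abs i) (ℤ→R-sign-abs j) ⟨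
    ℤ→R R i * ℤ→R R j                           ∎
    where
    s t : Sign
    s = sign i
    t = sign j
    a b : ℕ
    a = ∣ i ∣
    b = ∣ j ∣

  ℤ→R-homo-⊖ : ∀ a b → ℤ→R R (a ⊖ b) ≈ ℕ→R R a - ℕ→R R b
  ℤ→R-homo-⊖ zero    zero    = sym (-‿inverseʳ 0#)
  ℤ→R-homo-⊖ zero    (suc b) = sym (+-identityˡ _)
  ℤ→R-homo-⊖ (suc a) zero    = sym (trans (+-congˡ -0#≈0#) (+-identityʳ _))
  ℤ→R-homo-⊖ (suc a) (suc b) = begin
    ℤ→R R (suc a ⊖ suc b)           ≡⟨ ≡.cong (ℤ→R R) (ℤ.[1+m]⊖[1+n]≡m⊖n a b) ⟩
    ℤ→R R (a ⊖ b)                   ≈⟨ ℤ→R-homo-⊖ a b ⟩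
    ℕ→R R a - ℕ→R R b               ≈⟨ +-identityˡ _ ⟨
    0# + (ℕ→R R a - ℕ→R R b)        ≈⟨ +-congʳ (-‿inverseʳ 1#) ⟨
    (1# - 1#) + (ℕ→R R a - ℕ→R R b)
      ≈⟨ +-interchange 1# (- 1#) _ _ ⟩
    (1# + ℕ→R R a) + (- 1# + - ℕ→R R b)   ≈⟨ +-congˡ (-‿+-comm 1# (ℕ→R R b)) ⟩
    ℕ→R R (suc a) - ℕ→R R (suc b)   ∎

  ℤ→R-homo-+ : ∀ i j → ℤ→R R (i ℤ.+ j) ≈ ℤ→R R i + ℤ→R R j
  ℤ→R-homo-+ (+ a)    (+ b)    = ℕ→R-homo-+ a b
  ℤ→R-homo-+ (+ a)    -[1+ b ] = ℤ→R-homo-⊖ a (suc b)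
  ℤ→R-homo-+ -[1+ a ] (+ b)    = trans (ℤ→R-homo-⊖ b (suc a)) (+-comm _ _)
  ℤ→R-homo-+ -[1+ a ] -[1+ b ] = begin
    - ℕ→R R (suc (suc (a ℕ.+ b)))            ≈⟨ -‿cong (+-congˡ (+-congˡ (ℕ→R-homo-+ a b))) ⟩
    - (1# + (1# + (ℕ→R R a + ℕ→R R b)))      ≈⟨ -‿cong (+-assoc 1# 1# _) ⟨
    - ((1# + 1#) + (ℕ→R R a + ℕ→R R b))      ≈⟨ -‿cong (+-interchange 1# 1# _ _) ⟩
    - (ℕ→R R (suc a) + ℕ→R R (suc b))        ≈⟨ -‿+-comm _ _ ⟨
    - ℕ→R R (suc a) + - ℕ→R R (suc b)        ∎

  ℤ→R-homo-neg : ∀ i → ℤ→R R (ℤ.- i) ≈ - ℤ→R R i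
  ℤ→R-homo-neg -[1+ k ]    = sym (-‿involutive _)
  ℤ→R-homo-neg (+ zero)    = sym -0#≈0#
  ℤ→R-homo-neg (+ (suc k)) = refl

  ℤ→R-homo-minus : ∀ i j → ℤ→R R (i ℤ.- j) ≈ ℤ→R R i - ℤ→R R j
  ℤ→R-homo-minus i j = trans (ℤ→R-homo-+ i (ℤ.- j)) (+-congˡ (ℤ→R-homo-neg j))

  ℤ→R-injective : CharZero R → ∀ {i j} → ℤ→R R i ≈ ℤ→R R j → i ≡ j
  ℤ→R-injective charZero {i} {j} i≈j = ℤ.i-j≡0⇒i≡j i j (kernel-trivial (i ℤ.- j) (begin
    ℤ→R R (i ℤ.- j)           ≈⟨ ℤ→R-homo-minus i j ⟩
    ℤ→R R i - ℤ→R R j         ≈⟨ x≈y⇒x∙y⁻¹≈ε i≈j ⟩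
    0#                        ∎))
    where
    kernel-trivial : ∀ k → ℤ→R R k ≈ 0# → k ≡ + 0
    kernel-trivial (+ k)    k≈0 = ≡.cong +_ (charZero k k≈0)
    kernel-trivial -[1+ k ] k≈0 with charZero (suc k) (trans (sym (-‿involutive _)) (trans (-‿cong k≈0) -0#≈0#))
    ... | ()

module GroupCancellation (H : FinAbGroup) where
  open FinAbGroup H

  private
    group : Group _ _
    group = record { isGroup = IsAbelianGroup.isGroup isAbelianGroup }

  open import Algebra.Properties.Group group public
    using () renaming (\\-leftDividesˡ to h∙[h⁻¹∙g]≡g; \\-leftDividesʳ to h⁻¹∙[h∙g]≡g)

module GroupSums (H : FinAbGroup) {a ℓ} (M : CommutativeMonoid a ℓ) where
  open FinAbGroup H using (ΣH; order; enum; sumFin) renaming (Carrier to G; _∙_ to _·_; _⁻¹ to _⁻¹ᴳ)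
  open GroupCancellation H
  open CommutativeMonoid M
  open import Algebra.Properties.CommutativeMonoid.Sum M
    using (sum; sum-cong-≋; sum-cong-≗; ∑-distrib-+; ∑-comm; ∑-permute; sum-remove; sum-replicate; sum-replicate-zero)
  open import Algebra.Definitions.RawMonoid rawMonoid using (_×_)
  open import Relation.Binary.Reasoning.Setoid setoid
  open Inverse enum using (to; from; strictlyInverseˡ; strictlyInverseʳ)

  ∑ᴴ : (G → Carrier) → Carrier
  ∑ᴴ = ΣH _∙_ ε

  ∑ᴴ≡sum : ∀ f → ∑ᴴ f ≡ sum (f ∘ from)
  ∑ᴴ≡sum f = sumFin≡sum order (f ∘ from)
    where
    sumFin≡sum : ∀ m (t : Fin m → Carrier) → sumFin _∙_ ε m t ≡ sum t
    sumFin≡sum zero    t = ≡.refl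
    sumFin≡sum (suc m) t = ≡.cong (t zero ∙_) (sumFin≡sum m (t ∘ suc))

  ∑ᴴ-cong : ∀ {f f′ : G → Carrier} → (∀ g → f g ≈ f′ g) → ∑ᴴ f ≈ ∑ᴴ f′
  ∑ᴴ-cong {f} {f′} f≈f′ = begin
    ∑ᴴ f              ≡⟨ ∑ᴴ≡sum f ⟩
    sum (f ∘ from)    ≈⟨ sum-cong-≋ (f≈f′ ∘ from) ⟩
    sum (f′ ∘ from)   ≡⟨ ∑ᴴ≡sum f′ ⟨
    ∑ᴴ f′             ∎

  ∑ᴴ-distrib : ∀ (f f′ : G → Carrier) → ∑ᴴ (λ g → f g ∙ f′ g) ≈ ∑ᴴ f ∙ ∑ᴴ f′
  ∑ᴴ-distrib f f′ = begin
    ∑ᴴ (λ g → f g ∙ f′ g)             ≡⟨ ∑ᴴ≡sum (λ g → f g ∙ f′ g) ⟩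
    sum (λ i → f (from i) ∙ f′ (from i)) ≈⟨ ∑-distrib-+ (f ∘ from) (f′ ∘ from) ⟩
    sum (f ∘ from) ∙ sum (f′ ∘ from)   ≡⟨ ≡.cong₂ _∙_ (∑ᴴ≡sum f) (∑ᴴ≡sum f′) ⟨
    ∑ᴴ f ∙ ∑ᴴ f′                      ∎

  ∑ᴴ-comm : ∀ (f : G → G → Carrier) → ∑ᴴ (λ g → ∑ᴴ (f g)) ≈ ∑ᴴ (λ h → ∑ᴴ (λ g → f g h))
  ∑ᴴ-comm f = begin
    ∑ᴴ (λ g → ∑ᴴ (f g))                              ≈⟨ ∑ᴴ-cong (λ g → reflexive (∑ᴴ≡sum (f g))) ⟩
    ∑ᴴ (λ g → sum (f g ∘ from))                      ≡⟨ ∑ᴴ≡sum (λ g → sum (f g ∘ from)) ⟩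
    sum (λ i → sum (λ j → f (from i) (from j)))      ≈⟨ ∑-comm (λ i j → f (from i) (from j)) ⟩
    sum (λ j → sum (λ i → f (from i) (from j)))      ≡⟨ ∑ᴴ≡sum (λ h → sum (λ i → f (from i) h)) ⟨
    ∑ᴴ (λ h → sum (λ i → f (from i) h))              ≈⟨ ∑ᴴ-cong (λ h → reflexive (∑ᴴ≡sum (λ g → f g h))) ⟨
    ∑ᴴ (λ h → ∑ᴴ (λ g → f g h))                      ∎

  ∑ᴴ-const : ∀ x → ∑ᴴ (λ _ → x) ≈ order × x
  ∑ᴴ-const x = trans (reflexive (∑ᴴ≡sum (λ _ → x))) (sum-replicate order)

  ∑ᴴ-identity : ∀ {f : G → Carrier} → (∀ g → f g ≈ ε) → ∑ᴴ f ≈ ε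
  ∑ᴴ-identity {f} f≈ε = begin
    ∑ᴴ f                   ≡⟨ ∑ᴴ≡sum f ⟩
    sum (f ∘ from)         ≈⟨ sum-cong-≋ (f≈ε ∘ from) ⟩
    sum (replicate order ε) ≈⟨ sum-replicate-zero order ⟩
    ε                      ∎

  ∑ᴴ-translate : ∀ h (f : G → Carrier) → ∑ᴴ (λ g → f (h · g)) ≈ ∑ᴴ f
  ∑ᴴ-translate h f = begin
    ∑ᴴ (λ g → f (h · g))            ≡⟨ ∑ᴴ≡sum (λ g → f (h · g)) ⟩
    sum (λ i → f (h · from i))      ≡⟨ sum-cong-≗ (λ i → ≡.cong f (strictlyInverseʳ (h · from i))) ⟨
    sum (λ i → f (from (τ h i)))    ≈⟨ ∑-permute (f ∘ from) (mk↔ₛ′ (τ h) (τ (h ⁻¹ᴳ)) (τ-inverse (h∙[h⁻¹∙g]≡g h)) (τ-inverse (h⁻¹∙[h∙g]≡g h))) ⟨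
    sum (f ∘ from)                  ≡⟨ ∑ᴴ≡sum f ⟨
    ∑ᴴ f                            ∎
    where
    τ : G → Fin order → Fin order
    τ k i = to (k · from i)
    τ-inverse : ∀ {k k′} → (∀ g → k · (k′ · g) ≡ g) → ∀ i → τ k (τ k′ i) ≡ i
    τ-inverse {k} cancel i =
      ≡.trans (≡.cong (λ x → to (k · x)) (strictlyInverseʳ _))
              (≡.trans (≡.cong to (cancel (from i))) (strictlyInverseˡ i))

  ∑ᴴ-single : ∀ x (f : G → Carrier) → (∀ g → g ≢ x → f g ≈ ε) → ∑ᴴ f ≈ f x
  ∑ᴴ-single x f vanishes = begin
    ∑ᴴ f              ≡⟨ ∑ᴴ≡sum f ⟩
    sum (f ∘ from)    ≈⟨ sum-single (f ∘ from) (to x) vanishes′ ⟩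
    f (from (to x))   ≡⟨ ≡.cong f (strictlyInverseʳ x) ⟩
    f x               ∎
    where
    vanishes′ : ∀ i → i ≢ to x → f (from i) ≈ ε
    vanishes′ i i≢x = vanishes (from i) (λ i≡x → i≢x (≡.trans (≡.sym (strictlyInverseˡ i)) (≡.cong to i≡x)))
    sum-single : ∀ {m} (t : Fin m → Carrier) i → (∀ j → j ≢ i → t j ≈ ε) → sum t ≈ t i
    sum-single {suc m} t i t≈ε = begin
      sum t                         ≈⟨ sum-remove t ⟩
      t i ∙ sum (t ∘ punchIn i)     ≈⟨ ∙-congˡ (trans (sum-cong-≋ (λ j → t≈ε _ (punchInᵢ≢i i j))) (sum-replicate-zero m)) ⟩
      t i ∙ ε                       ≈⟨ identityʳ (t i) ⟩
      t i                           ∎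

module RingPowers {c ℓ} (R : CommutativeRing c ℓ) where
  open CommutativeRing R
  open import Algebra.Properties.Semiring.Exp semiring using (_^_; ^-homo-*; ^-assocʳ; ^-congˡ; ^-congʳ)
  open import Relation.Binary.Reasoning.Setoid setoid

  1#^k≈1# : ∀ k → 1# ^ k ≈ 1#
  1#^k≈1# zero    = refl
  1#^k≈1# (suc k) = trans (*-congˡ (1#^k≈1# k)) (*-identityˡ 1#)

  ^-mod : ∀ {u N} .{{_ : ℕ.NonZero N}} → u ^ N ≈ 1# → ∀ a → u ^ a ≈ u ^ (a % N)
  ^-mod {u} {N} u^N≈1 a = begin
    u ^ a                                ≡⟨ ≡.cong (u ^_) (m≡m%n+[m/n]*n a N) ⟩
    u ^ (a % N ℕ.+ a / N ℕ.* N)          ≈⟨ ^-homo-* u (a % N) _ ⟩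
    u ^ (a % N) * u ^ (a / N ℕ.* N)      ≡⟨ ≡.cong (λ t → u ^ (a % N) * u ^ t) (ℕ.*-comm (a / N) N) ⟩
    u ^ (a % N) * u ^ (N ℕ.* (a / N))    ≈⟨ *-congˡ (^-assocʳ u N (a / N)) ⟨
    u ^ (a % N) * (u ^ N) ^ (a / N)      ≈⟨ *-congˡ (trans (^-congˡ (a / N) u^N≈1) (1#^k≈1# (a / N))) ⟩
    u ^ (a % N) * 1#                     ≈⟨ *-identityʳ _ ⟩
    u ^ (a % N)                          ∎

  ^-odd-of-involution : ∀ {v} q → v ^ 2 ≈ 1# → v ^ suc (2 ℕ.* q) ≈ v
  ^-odd-of-involution {v} q v²≈1 = begin
    v * v ^ (2 ℕ.* q)          ≈⟨ *-congˡ (^-assocʳ v 2 q) ⟨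
    v * (v ^ 2) ^ q            ≈⟨ *-congˡ (trans (^-congˡ q v²≈1) (1#^k≈1# q)) ⟩
    v * 1#                     ≈⟨ *-identityʳ v ⟩
    v                          ∎

  ^2^k≈1⇒≈1 : ∀ {u} q → u ^ suc (2 ℕ.* q) ≈ 1# → ∀ k → u ^ (2 ℕ.^ k) ≈ 1# → u ≈ 1#
  ^2^k≈1⇒≈1 {u} q u^odd≈1 zero    u¹≈1 = trans (sym (*-identityʳ u)) u¹≈1
  ^2^k≈1⇒≈1 {u} q u^odd≈1 (suc k) u^2^[1+k]≈1 = ^2^k≈1⇒≈1 q u^odd≈1 k (begin
    v                     ≈⟨ ^-odd-of-involution q v²≈1 ⟨
    v ^ odd               ≈⟨ ^-assocʳ u (2 ℕ.^ k) odd ⟩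
    u ^ (2 ℕ.^ k ℕ.* odd) ≡⟨ ≡.cong (u ^_) (ℕ.*-comm (2 ℕ.^ k) odd) ⟩
    u ^ (odd ℕ.* 2 ℕ.^ k) ≈⟨ ^-assocʳ u odd (2 ℕ.^ k) ⟨
    (u ^ odd) ^ 2 ℕ.^ k   ≈⟨ trans (^-congˡ (2 ℕ.^ k) u^odd≈1) (1#^k≈1# (2 ℕ.^ k)) ⟩
    1#                    ∎)
    where
    odd : ℕ
    odd = suc (2 ℕ.* q)
    v : Carrier
    v = u ^ (2 ℕ.^ k)
    v²≈1 : v ^ 2 ≈ 1#
    v²≈1 = trans (^-assocʳ u (2 ℕ.^ k) 2) (trans (^-congʳ u (ℕ.*-comm (2 ℕ.^ k) 2)) u^2^[1+k]≈1)

module QuadraticRecurrence (m : ℕ) where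

  y : ℕ → ℤ
  y zero    = + 0
  y (suc k) = + m ℤ.- y k ℤ.* y k

  private
    i*i≡+∣i∣*∣i∣ : ∀ i → i ℤ.* i ≡ + (∣ i ∣ ℕ.* ∣ i ∣)
    i*i≡+∣i∣*∣i∣ (+ a)    = ℤ.+◃n≡+n (a ℕ.* a)
    i*i≡+∣i∣*∣i∣ -[1+ a ] = ℤ.+◃n≡+n (suc a ℕ.* suc a)

  ∣y[1+k]∣≡∣m⊖∣y[k]∣²∣ : ∀ k → ∣ y (suc k) ∣ ≡ ∣ m ⊖ ∣ y k ∣ ℕ.* ∣ y k ∣ ∣
  ∣y[1+k]∣≡∣m⊖∣y[k]∣²∣ k =
    ≡.cong ∣_∣ (≡.trans (≡.cong (λ t → + m ℤ.- t) (i*i≡+∣i∣*∣i∣ (y k))) (ℤ.m-n≡m⊖n m (∣ y k ∣ ℕ.* ∣ y k ∣)))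

  module _ (4≤m : 4 ≤ m) where

    ∣m⊖w²∣-growth : ∀ {w} → m ≤ w → w < ∣ m ⊖ w ℕ.* w ∣
    ∣m⊖w²∣-growth {w} m≤w = begin-strict
      w                   <⟨ ℕ.m+n≤o⇒m≤o∸n (suc w) suc[w]+m≤w² ⟩
      w ℕ.* w ℕ.∸ m       ≡⟨ ℤ.∣⊖∣-≤ (ℕ.≤-trans (ℕ.m≤n+m m (suc w)) suc[w]+m≤w²) ⟨
      ∣ m ⊖ w ℕ.* w ∣     ∎
      where
      open ℕ.≤-Reasoning
      4≤w : 4 ≤ w
      4≤w = ℕ.≤-trans 4≤m m≤w
      suc[w]+m≤w² : suc w ℕ.+ m ≤ w ℕ.* w
      suc[w]+m≤w² = begin
        suc w ℕ.+ m                   ≤⟨ ℕ.+-mono-≤ (ℕ.+-monoˡ-≤ w (ℕ.≤-trans (s≤s z≤n) 4≤w)) (ℕ.≤-trans m≤w (ℕ.m≤m+n w _)) ⟩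
        (w ℕ.+ w) ℕ.+ (w ℕ.+ (w ℕ.+ 0)) ≡⟨ ℕ.+-assoc w w _ ⟩
        4 ℕ.* w                       ≤⟨ ℕ.*-monoˡ-≤ w 4≤w ⟩
        w ℕ.* w                       ∎

    m≤∣y[1+k]∣ : ∀ k → m ≤ ∣ y (suc k) ∣
    ∣y∣-increasing : ∀ k → ∣ y k ∣ < ∣ y (suc k) ∣

    m≤∣y[1+k]∣ zero    = ℕ.≤-reflexive (≡.sym (≡.trans (∣y[1+k]∣≡∣m⊖∣y[k]∣²∣ 0) (≡.cong ∣_∣ (ℤ.⊖-≥ z≤n))))
    m≤∣y[1+k]∣ (suc k) = ℕ.≤-trans (m≤∣y[1+k]∣ k) (ℕ.<⇒≤ (∣y∣-increasing (suc k)))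

    ∣y∣-increasing zero    = ℕ.<-≤-trans (s≤s z≤n) (ℕ.≤-trans 4≤m (m≤∣y[1+k]∣ 0))
    ∣y∣-increasing (suc k) = ℕ.<-≤-trans (∣m⊖w²∣-growth (m≤∣y[1+k]∣ k))
                                          (ℕ.≤-reflexive (≡.sym (∣y[1+k]∣≡∣m⊖∣y[k]∣²∣ (suc k))))

    ∣y∣-strictMono : ∀ {i j} → i < j → ∣ y i ∣ < ∣ y j ∣
    ∣y∣-strictMono {i} {suc j} (s≤s i≤j) with ℕ.m≤n⇒m<n∨m≡n i≤j
    ... | inj₁ i<j    = ℕ.<-trans (∣y∣-strictMono i<j) (∣y∣-increasing j)
    ... | inj₂ ≡.refl = ∣y∣-increasing j

    y-injective : ∀ {i j} → i < j → y i ≢ y j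
    y-injective i<j yi≡yj = ℕ.<-irrefl (≡.cong ∣_∣ yi≡yj) (∣y∣-strictMono i<j)

module CharacterEvaluation (H : FinAbGroup) {c ℓ} (R : CommutativeRing c ℓ) where
  open FinAbGroup H renaming (Carrier to G; _∙_ to _⋆_)
  open CommutativeRing R hiding (zero)
  open import Data.Product using (_×_)
  open import Algebra.Properties.Ring ring using (-1*x≈-x; [y-z]x≈yx-zx; x∙y⁻¹≈ε⇒x≈y; xyx⁻¹≈y; ⁻¹-anti-homo‿-)
  open import Algebra.Properties.CommutativeSemigroup *-commutativeSemigroup using (x∙yz≈y∙xz)
  open import Algebra.Properties.Semiring.Exp semiring using (_^_; ^-congˡ; ^-congʳ; ^-assocʳ)
  open import Algebra.Properties.CommutativeSemiring.Exp commutativeSemiring using (^-distrib-*)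
  open import Algebra.Properties.Semiring.Sum semiring using (sum; *-distribˡ-sum)
  open import Relation.Binary.Reasoning.Setoid setoid
  open IntegerEmbedding R
  open RingPowers R using (1#^k≈1#; ^-mod; ^2^k≈1⇒≈1)
  open GroupCancellation H
  open GroupSums H +-commutativeMonoid
  open GroupSums H *-commutativeMonoid using ()
    renaming (∑ᴴ to ∏ᴴ; ∑ᴴ-cong to ∏ᴴ-cong; ∑ᴴ-distrib to ∏ᴴ-distrib; ∑ᴴ-const to ∏ᴴ-const;
              ∑ᴴ-identity to ∏ᴴ-identity; ∑ᴴ-translate to ∏ᴴ-translate)
  open IsAbelianGroup isAbelianGroup using () renaming (inverseʳ to ⋆-inverseʳ)
  open Character

  Char : Set (c ⊔ ℓ)
  Char = Character H R

  ev : Char → ZH → Carrier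
  ev = evalχ H R

  summand : Char → ZH → G → Carrier
  summand X A g = ℤ→R R (A g) * χ X g

  ∑ᴴ-*-distribˡ : ∀ a (f : G → Carrier) → ∑ᴴ (λ g → a * f g) ≈ a * ∑ᴴ f
  ∑ᴴ-*-distribˡ a f = begin
    ∑ᴴ (λ g → a * f g)       ≡⟨ ∑ᴴ≡sum (λ g → a * f g) ⟩
    sum (λ i → a * f (from i)) ≈⟨ *-distribˡ-sum a (λ i → f (from i)) ⟨
    a * sum (λ i → f (from i)) ≡⟨ ≡.cong (a *_) (∑ᴴ≡sum f) ⟨
    a * ∑ᴴ f                 ∎
    where open Inverse enum using (from)

  ∑ᴴ-*-distribʳ : ∀ a (f : G → Carrier) → ∑ᴴ (λ g → f g * a) ≈ ∑ᴴ f * a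
  ∑ᴴ-*-distribʳ a f = trans (∑ᴴ-cong {λ g → f g * a} (λ g → *-comm (f g) a)) (trans (∑ᴴ-*-distribˡ a f) (*-comm a (∑ᴴ f)))

  ℤ→R-homo-ΣH : ∀ (f : G → ℤ) → ℤ→R R (ΣH ℤ._+_ (+ 0) f) ≈ ∑ᴴ (λ g → ℤ→R R (f g))
  ℤ→R-homo-ΣH f = homo-sumFin order (λ i → f (from i))
    where
    open Inverse enum using (from)
    homo-sumFin : ∀ m (t : Fin m → ℤ) → ℤ→R R (sumFin ℤ._+_ (+ 0) m t) ≈ sumFin _+_ 0# m (λ i → ℤ→R R (t i))
    homo-sumFin zero    t = refl
    homo-sumFin (suc m) t = trans (ℤ→R-homo-+ (t zero) _) (+-congˡ (homo-sumFin m (λ i → t (suc i))))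

  evalχ-cong : ∀ (X : Char) {A B} → A ≐ B → ev X A ≈ ev X B
  evalχ-cong X {A} {B} A≐B = ∑ᴴ-cong {summand X A} {summand X B} (λ g → *-congʳ (reflexive (≡.cong (ℤ→R R) (A≐B g))))

  evalχ-cong-χ : ∀ (X Y : Char) → (∀ g → χ X g ≈ χ Y g) → ∀ A → ev X A ≈ ev Y A
  evalχ-cong-χ X Y X≈Y A = ∑ᴴ-cong {summand X A} {summand Y A} (λ g → *-congˡ (X≈Y g))

  evalχ-homo-⊕ : ∀ (X : Char) A B → ev X (A ⊕ B) ≈ ev X A + ev X B
  evalχ-homo-⊕ X A B = trans
    (∑ᴴ-cong {summand X (A ⊕ B)} (λ g → trans (*-congʳ (ℤ→R-homo-+ (A g) (B g))) (distribʳ (χ X g) _ _)))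
    (∑ᴴ-distrib (summand X A) (summand X B))

  evalχ-homo-· : ∀ (X : Char) k A → ev X (k · A) ≈ ℤ→R R k * ev X A
  evalχ-homo-· X k A = trans
    (∑ᴴ-cong {summand X (k · A)} (λ g → trans (*-congʳ (ℤ→R-homo-* k (A g))) (*-assoc _ _ _)))
    (∑ᴴ-*-distribˡ (ℤ→R R k) (summand X A))

  evalχ-homo-⊖ : ∀ (X : Char) A → ev X (⊖ A) ≈ - ev X A
  evalχ-homo-⊖ X A = begin
    ev X (⊖ A)                                ≈⟨ ∑ᴴ-cong {summand X (⊖ A)} (λ g → trans (*-congʳ (trans (ℤ→R-homo-neg (A g)) (sym (-1*x≈-x _)))) (*-assoc _ _ _)) ⟩
    ∑ᴴ (λ g → - 1# * summand X A g)           ≈⟨ ∑ᴴ-*-distribˡ (- 1#) (summand X A) ⟩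
    - 1# * ev X A                             ≈⟨ -1*x≈-x _ ⟩
    - ev X A                                  ∎

  evalχ-eZ : ∀ (X : Char) → ev X eZ ≈ 1#
  evalχ-eZ X = begin
    ev X eZ
      ≈⟨ ∑ᴴ-single e (summand X eZ)
           (λ g g≢e → trans (*-congʳ (reflexive (≡.cong (λ b → ℤ→R R (if b then + 1 else + 0)) (dec-false (g ≟ e) g≢e))))
                            (zeroˡ _)) ⟩
    ℤ→R R (eZ e) * χ X e     ≡⟨ ≡.cong (λ b → ℤ→R R (if b then + 1 else + 0) * χ X e) (dec-true (e ≟ e) ≡.refl) ⟩
    (1# + 0#) * χ X e        ≈⟨ *-cong (+-identityʳ 1#) (χ-e X) ⟩
    1# * 1#                  ≈⟨ *-identityˡ 1# ⟩
    1#                       ∎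

  χ-∑ᴴ-invariant : ∀ (X : Char) g → χ X g * ∑ᴴ (χ X) ≈ ∑ᴴ (χ X)
  χ-∑ᴴ-invariant X g = begin
    χ X g * ∑ᴴ (χ X)              ≈⟨ ∑ᴴ-*-distribˡ (χ X g) (χ X) ⟨
    ∑ᴴ (λ h → χ X g * χ X h)      ≈⟨ ∑ᴴ-cong {λ h → χ X g * χ X h} (λ h → sym (χ-hom X g h)) ⟩
    ∑ᴴ (λ h → χ X (g ⋆ h))        ≈⟨ ∑ᴴ-translate g (χ X) ⟩
    ∑ᴴ (χ X)                      ∎

  ∑χ≈0 : IntegralDomain R → ∀ (X : Char) g → ¬ χ X g ≈ 1# → ∑ᴴ (χ X) ≈ 0#
  ∑χ≈0 domain X g χg≉1 with domain (χ X g - 1#) (∑ᴴ (χ X)) (begin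
      (χ X g - 1#) * ∑ᴴ (χ X)              ≈⟨ [y-z]x≈yx-zx _ _ _ ⟩
      χ X g * ∑ᴴ (χ X) - 1# * ∑ᴴ (χ X)     ≈⟨ +-cong (χ-∑ᴴ-invariant X g) (-‿cong (*-identityˡ _)) ⟩
      ∑ᴴ (χ X) - ∑ᴴ (χ X)                  ≈⟨ -‿inverseʳ _ ⟩
      0#                                   ∎)
  ... | inj₁ χg-1≈0 = ⊥-elim (χg≉1 (x∙y⁻¹≈ε⇒x≈y _ _ χg-1≈0))
  ... | inj₂ ∑χ≈0′  = ∑χ≈0′

  evalχ-HZ : IntegralDomain R → ∀ (X : Char) g → ¬ χ X g ≈ 1# → ev X HZ ≈ 0#
  evalχ-HZ domain X g χg≉1 =
    trans (∑ᴴ-cong {summand X HZ} (λ h → trans (*-congʳ (+-identityʳ 1#)) (*-identityˡ _))) (∑χ≈0 domain X g χg≉1)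

  evalχ-ΣH : ∀ (X : Char) (F : G → G → ℤ) →
             ev X (λ x → ΣH ℤ._+_ (+ 0) (F x)) ≈ ∑ᴴ (λ y → ∑ᴴ (λ x → ℤ→R R (F x y) * χ X x))
  evalχ-ΣH X F = begin
    ev X (λ x → ΣH ℤ._+_ (+ 0) (F x))
      ≈⟨ ∑ᴴ-cong {summand X (λ x → ΣH ℤ._+_ (+ 0) (F x))}
           (λ x → trans (*-congʳ (ℤ→R-homo-ΣH (F x))) (sym (∑ᴴ-*-distribʳ (χ X x) (λ y → ℤ→R R (F x y))))) ⟩
    ∑ᴴ (λ x → ∑ᴴ (λ y → ℤ→R R (F x y) * χ X x))   ≈⟨ ∑ᴴ-comm (λ x y → ℤ→R R (F x y) * χ X x) ⟩
    ∑ᴴ (λ y → ∑ᴴ (λ x → ℤ→R R (F x y) * χ X x))   ∎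

  evalχ-shift : ∀ (X : Char) B h → ∑ᴴ (λ x → ℤ→R R (B (h ⁻¹ ⋆ x)) * χ X x) ≈ χ X h * ev X B
  evalχ-shift X B h = begin
    ∑ᴴ (λ x → ℤ→R R (B (h ⁻¹ ⋆ x)) * χ X x)               ≈⟨ ∑ᴴ-translate h (λ x → ℤ→R R (B (h ⁻¹ ⋆ x)) * χ X x) ⟨
    ∑ᴴ (λ x → ℤ→R R (B (h ⁻¹ ⋆ (h ⋆ x))) * χ X (h ⋆ x))   ≈⟨ ∑ᴴ-cong {λ x → ℤ→R R (B (h ⁻¹ ⋆ (h ⋆ x))) * χ X (h ⋆ x)} shifted ⟩
    ∑ᴴ (λ x → χ X h * summand X B x)                     ≈⟨ ∑ᴴ-*-distribˡ (χ X h) (summand X B) ⟩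
    χ X h * ev X B                                       ∎
    where
    shifted : ∀ x → ℤ→R R (B (h ⁻¹ ⋆ (h ⋆ x))) * χ X (h ⋆ x) ≈ χ X h * summand X B x
    shifted x = begin
      ℤ→R R (B (h ⁻¹ ⋆ (h ⋆ x))) * χ X (h ⋆ x)  ≈⟨ *-cong (reflexive (≡.cong (ℤ→R R ∘ B) (h⁻¹∙[h∙g]≡g h x))) (χ-hom X h x) ⟩
      ℤ→R R (B x) * (χ X h * χ X x)            ≈⟨ x∙yz≈y∙xz _ _ _ ⟩
      χ X h * summand X B x                    ∎

  evalχ-homo-⊛ : ∀ (X : Char) A B → ev X (A ⊛ B) ≈ ev X A * ev X B
  evalχ-homo-⊛ X A B = begin
    ev X (A ⊛ B)
      ≈⟨ evalχ-ΣH X (λ x h → A h ℤ.* B (h ⁻¹ ⋆ x)) ⟩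
    ∑ᴴ (λ h → ∑ᴴ (λ x → ℤ→R R (A h ℤ.* B (h ⁻¹ ⋆ x)) * χ X x))
      ≈⟨ ∑ᴴ-cong {λ h → ∑ᴴ (λ x → ℤ→R R (A h ℤ.* B (h ⁻¹ ⋆ x)) * χ X x)} factor ⟩
    ∑ᴴ (λ h → summand X A h * ev X B)
      ≈⟨ ∑ᴴ-*-distribʳ (ev X B) (summand X A) ⟩
    ev X A * ev X B ∎
    where
    factor : ∀ h → ∑ᴴ (λ x → ℤ→R R (A h ℤ.* B (h ⁻¹ ⋆ x)) * χ X x) ≈ summand X A h * ev X B
    factor h = begin
      ∑ᴴ (λ x → ℤ→R R (A h ℤ.* B (h ⁻¹ ⋆ x)) * χ X x)
        ≈⟨ ∑ᴴ-cong {λ x → ℤ→R R (A h ℤ.* B (h ⁻¹ ⋆ x)) * χ X x}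
             (λ x → trans (*-congʳ (ℤ→R-homo-* (A h) _)) (*-assoc _ _ _)) ⟩
      ∑ᴴ (λ x → ℤ→R R (A h) * (ℤ→R R (B (h ⁻¹ ⋆ x)) * χ X x))
        ≈⟨ ∑ᴴ-*-distribˡ (ℤ→R R (A h)) (λ x → ℤ→R R (B (h ⁻¹ ⋆ x)) * χ X x) ⟩
      ℤ→R R (A h) * ∑ᴴ (λ x → ℤ→R R (B (h ⁻¹ ⋆ x)) * χ X x)
        ≈⟨ *-congˡ (evalχ-shift X B h) ⟩
      ℤ→R R (A h) * (χ X h * ev X B)
        ≈⟨ *-assoc _ _ _ ⟨
      summand X A h * ev X B ∎

  _^χ_ : Char → ℕ → Char
  X ^χ k = record
    { χ     = λ g → χ X g ^ k
    ; χ-e   = trans (^-congˡ k (χ-e X)) (1#^k≈1# k)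
    ; χ-hom = λ g h → trans (^-congˡ k (χ-hom X g h)) (^-distrib-* (χ X g) (χ X h) k)
    }

  evalχ-sq⁽²⁾ : ∀ (X : Char) A → ev X (sq⁽²⁾ A) ≈ ev (X ^χ 2) A
  evalχ-sq⁽²⁾ X A = begin
    ev X (sq⁽²⁾ A)                                 ≈⟨ evalχ-ΣH X δ ⟩
    ∑ᴴ (λ g → ∑ᴴ (λ x → ℤ→R R (δ x g) * χ X x))   ≈⟨ ∑ᴴ-cong {λ g → ∑ᴴ (λ x → ℤ→R R (δ x g) * χ X x)} at-square ⟩
    ev (X ^χ 2) A                                  ∎
    where
    δ : G → G → ℤ
    δ x g = if does ((g ⋆ g) ≟ x) then A g else + 0
    at-square : ∀ g → ∑ᴴ (λ x → ℤ→R R (δ x g) * χ X x) ≈ summand (X ^χ 2) A g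
    at-square g = begin
      ∑ᴴ (λ x → ℤ→R R (δ x g) * χ X x)
        ≈⟨ ∑ᴴ-single (g ⋆ g) (λ x → ℤ→R R (δ x g) * χ X x)
             (λ x x≢g² → trans (*-congʳ (reflexive (≡.cong (λ b → ℤ→R R (if b then A g else + 0))
                                                        (dec-false ((g ⋆ g) ≟ x) (x≢g² ∘ ≡.sym)))))
                               (zeroˡ _)) ⟩
      ℤ→R R (δ (g ⋆ g) g) * χ X (g ⋆ g)
        ≡⟨ ≡.cong (λ b → ℤ→R R (if b then A g else + 0) * χ X (g ⋆ g)) (dec-true ((g ⋆ g) ≟ (g ⋆ g)) ≡.refl) ⟩
      ℤ→R R (A g) * χ X (g ⋆ g)
        ≈⟨ *-congˡ (trans (χ-hom X g g) (*-congˡ (sym (*-identityʳ _)))) ⟩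
      summand (X ^χ 2) A g ∎

  χ^order≈1 : ∀ (X : Char) g → χ X g ^ order ≈ 1#
  χ^order≈1 X g = begin
    u ^ order              ≈⟨ *-identityʳ _ ⟨
    u ^ order * 1#         ≈⟨ *-congˡ PQ≈1 ⟨
    u ^ order * (P * Q)    ≈⟨ *-assoc _ _ _ ⟨
    (u ^ order * P) * Q    ≈⟨ *-congʳ uᴺP≈P ⟩
    P * Q                  ≈⟨ PQ≈1 ⟩
    1#                     ∎
    where
    u P Q : Carrier
    u = χ X g
    P = ∏ᴴ (χ X)
    Q = ∏ᴴ (λ h → χ X (h ⁻¹))
    PQ≈1 : P * Q ≈ 1#
    PQ≈1 = trans (sym (∏ᴴ-distrib (χ X) (λ h → χ X (h ⁻¹))))
                 (∏ᴴ-identity (λ h → trans (sym (χ-hom X h (h ⁻¹))) (trans (reflexive (≡.cong (χ X) (⋆-inverseʳ h))) (χ-e X))))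
    uᴺP≈P : u ^ order * P ≈ P
    uᴺP≈P = begin
      u ^ order * P               ≈⟨ *-congʳ (∏ᴴ-const u) ⟨
      ∏ᴴ (λ _ → u) * P            ≈⟨ ∏ᴴ-distrib (λ _ → u) (χ X) ⟨
      ∏ᴴ (λ h → u * χ X h)        ≈⟨ ∏ᴴ-cong {λ h → u * χ X h} (λ h → sym (χ-hom X g h)) ⟩
      ∏ᴴ (λ h → χ X (g ⋆ h))      ≈⟨ ∏ᴴ-translate g (χ X) ⟩
      P                           ∎

  ^χ-2^k-nontrivial : ∀ q → order ≡ suc (2 ℕ.* q) → ∀ (X : Char) {g} → ¬ χ X g ≈ 1# →
                      ∀ k → ¬ χ (X ^χ (2 ℕ.^ k)) g ≈ 1#
  ^χ-2^k-nontrivial q odd-order X {g} χg≉1 k =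
    χg≉1 ∘ ^2^k≈1⇒≈1 q (trans (^-congʳ (χ X g) (≡.sym odd-order)) (χ^order≈1 X g)) k

  private instance
    order-nonZero : ℕ.NonZero order
    order-nonZero = nonZeroIndex (Inverse.to enum e)

  evalχ-2^k-repeats : ∀ (X : Char) A → ∃₂ λ i j → i ℕ.< j × ev (X ^χ (2 ℕ.^ i)) A ≈ ev (X ^χ (2 ℕ.^ j)) A
  evalχ-2^k-repeats X A with pigeonhole (ℕ.n<1+n order) (λ k → (2 ℕ.^ toℕ k) mod order)
  ... | i , j , i<j , same-residue = toℕ i , toℕ j , i<j , evalχ-cong-χ (X ^χ a) (X ^χ b) same-values A
    where
    a b : ℕ
    a = 2 ℕ.^ toℕ i
    b = 2 ℕ.^ toℕ j
    a%≡b% : a % order ≡ b % order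
    a%≡b% = ≡.trans (≡.sym (toℕ-fromℕ< _)) (≡.trans (≡.cong toℕ same-residue) (toℕ-fromℕ< _))
    same-values : ∀ g → χ X g ^ a ≈ χ X g ^ b
    same-values g = begin
      χ X g ^ a            ≈⟨ ^-mod (χ^order≈1 X g) a ⟩
      χ X g ^ (a % order)  ≡⟨ ≡.cong (χ X g ^_) a%≡b% ⟩
      χ X g ^ (b % order)  ≈⟨ ^-mod (χ^order≈1 X g) b ⟨
      χ X g ^ b            ∎

  evalχ-^χ-^χ : ∀ (X : Char) a b A → ev ((X ^χ a) ^χ b) A ≈ ev (X ^χ (b ℕ.* a)) A
  evalχ-^χ-^χ X a b = evalχ-cong-χ ((X ^χ a) ^χ b) (X ^χ (b ℕ.* a))
    (λ g → trans (^-assocʳ (χ X g) a b) (^-congʳ (χ X g) (ℕ.*-comm a b)))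

  evalχ-square-relation :
    IntegralDomain R → ∀ (X : Char) {g} → ¬ χ X g ≈ 1# → ∀ {A a c} →
    (A ⊛ A) ≐ (((a · HZ) ⊕ (⊖ sq⁽²⁾ A)) ⊕ (c · eZ)) →
    ev (X ^χ 2) A ≈ ℤ→R R c - ev X A * ev X A
  evalχ-square-relation domain X {g} χg≉1 {A} {a} {c} A²≐ = begin
    ev (X ^χ 2) A                        ≈⟨ xyx⁻¹≈y C (ev (X ^χ 2) A) ⟨
    C + ev (X ^χ 2) A - C                ≈⟨ +-assoc C _ (- C) ⟩
    C + (ev (X ^χ 2) A - C)              ≈⟨ +-congˡ (⁻¹-anti-homo‿- C (ev (X ^χ 2) A)) ⟨
    C - (C - ev (X ^χ 2) A)              ≈⟨ +-congˡ (-‿cong ev[A²]) ⟨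
    C - ev X A * ev X A                  ∎
    where
    C : Carrier
    C = ℤ→R R c
    ev[A²] : ev X A * ev X A ≈ C - ev (X ^χ 2) A
    ev[A²] = begin
      ev X A * ev X A                                  ≈⟨ evalχ-homo-⊛ X A A ⟨
      ev X (A ⊛ A)                                     ≈⟨ evalχ-cong X A²≐ ⟩
      ev X (((a · HZ) ⊕ (⊖ sq⁽²⁾ A)) ⊕ (c · eZ))        ≈⟨ evalχ-homo-⊕ X ((a · HZ) ⊕ (⊖ sq⁽²⁾ A)) (c · eZ) ⟩
      ev X ((a · HZ) ⊕ (⊖ sq⁽²⁾ A)) + ev X (c · eZ)     ≈⟨ +-cong (evalχ-homo-⊕ X (a · HZ) (⊖ sq⁽²⁾ A)) (evalχ-homo-· X c eZ) ⟩
      (ev X (a · HZ) + ev X (⊖ sq⁽²⁾ A)) + ℤ→R R c * ev X eZ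
        ≈⟨ +-cong (+-cong (evalχ-homo-· X a HZ) (evalχ-homo-⊖ X (sq⁽²⁾ A))) (*-congˡ (evalχ-eZ X)) ⟩
      (ℤ→R R a * ev X HZ + - ev X (sq⁽²⁾ A)) + ℤ→R R c * 1#
        ≈⟨ +-cong (+-cong (trans (*-congˡ (evalχ-HZ domain X g χg≉1)) (zeroʳ _)) (-‿cong (evalχ-sq⁽²⁾ X A))) (*-identityʳ _) ⟩
      (0# + - ev (X ^χ 2) A) + C                       ≈⟨ +-congʳ (+-identityˡ _) ⟩
      - ev (X ^χ 2) A + C                              ≈⟨ +-comm _ C ⟩
      C - ev (X ^χ 2) A                                ∎

  evalχ-2^k-orbit :
    IntegralDomain R → ∀ q → order ≡ suc (2 ℕ.* q) → ∀ {A a m} →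
    (A ⊛ A) ≐ (((a · HZ) ⊕ (⊖ sq⁽²⁾ A)) ⊕ ((+ m) · eZ)) →
    ∀ (X : Char) {g} → ¬ χ X g ≈ 1# → ev X A ≈ 0# →
    ∀ k → ev (X ^χ (2 ℕ.^ k)) A ≈ ℤ→R R (QuadraticRecurrence.y m k)
  evalχ-2^k-orbit domain q odd-order {A} {a} {m} A²≐ X χg≉1 χ[A]≈0 = orbit
    where
    open QuadraticRecurrence m using (y)
    orbit : ∀ k → ev (X ^χ (2 ℕ.^ k)) A ≈ ℤ→R R (y k)
    orbit zero    = trans (evalχ-cong-χ (X ^χ 1) X (λ h → *-identityʳ (χ X h)) A) χ[A]≈0
    orbit (suc k) = begin
      ev (X ^χ (2 ℕ.^ suc k)) A                      ≈⟨ evalχ-^χ-^χ X (2 ℕ.^ k) 2 A ⟨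
      ev (ψ ^χ 2) A                                  ≈⟨ evalχ-square-relation domain ψ (^χ-2^k-nontrivial q odd-order X χg≉1 k) {A} {a} {+ m} A²≐ ⟩
      ℤ→R R (+ m) - ev ψ A * ev ψ A                  ≈⟨ +-congˡ (-‿cong (*-cong (orbit k) (orbit k))) ⟩
      ℤ→R R (+ m) - ℤ→R R (y k) * ℤ→R R (y k)       ≈⟨ +-congˡ (-‿cong (ℤ→R-homo-* (y k) (y k))) ⟨
      ℤ→R R (+ m) - ℤ→R R (y k ℤ.* y k)              ≈⟨ ℤ→R-homo-minus (+ m) (y k ℤ.* y k) ⟨
      ℤ→R R (y (suc k))                              ∎
      where
      ψ : Char
      ψ = X ^χ (2 ℕ.^ k)

open IntegerEmbedding using (ℤ→R-injective)
open QuadraticRecurrence using (y; y-injective)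
open CharacterEvaluation using (evalχ-2^k-repeats; evalχ-2^k-orbit)

open import Data.Nat using (_*_; _+_; _∸_; _^_)

lemma3 : (n : ℕ) → 3 ≤ n → (H : FinAbGroup) → FinAbGroup.order H ≡ 2 * n * n + 1 →
           (T : FinAbGroup.Subset H) →
           FinAbGroup.∣_∣ H T ≡ 2 * n →
           FinAbGroup._≐_ H (FinAbGroup.⟦_⟧ H T) (FinAbGroup.inv⁽⁻¹⁾ H (FinAbGroup.⟦_⟧ H T)) →
           FinAbGroup._≐_ H
             (FinAbGroup._⊛_ H (FinAbGroup.⟦_⟧ H T) (FinAbGroup.⟦_⟧ H T))
             (FinAbGroup._⊕_ H
               (FinAbGroup._⊕_ H (FinAbGroup._·_ H (+ 2) (FinAbGroup.HZ H))
                                 (FinAbGroup.⊖_ H (FinAbGroup.sq⁽²⁾ H (FinAbGroup.⟦_⟧ H T))))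
               (FinAbGroup._·_ H (+ (2 * n Data.Nat.∸ 2)) (FinAbGroup.eZ H))) →
           ∀ {c ℓ} (R : CommutativeRing c ℓ) → CharZero R → IntegralDomain R →
           (X : Character H R) → Nontrivial H R X →
           ¬ (CommutativeRing._≈_ R (evalχ H R X (FinAbGroup.⟦_⟧ H T)) (CommutativeRing.0# R))
lemma3 n 3≤n H ord T _ _ T²≐ R charZero domain X (g , χg≉1) χ[T]≈0
  with evalχ-2^k-repeats H R X (FinAbGroup.⟦_⟧ H T)
... | i , j , i<j , repeat =
  y-injective m 4≤m i<j (ℤ→R-injective R charZero (trans (sym (orbit i)) (trans repeat (orbit j))))
  where
  open CommutativeRing R using (_≈_; trans; sym)
  open CharacterEvaluation H R using (ev; _^χ_)
  m : ℕ
  m = 2 * n ∸ 2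
  4≤m : 4 ≤ m
  4≤m = ℕ.m+n≤o⇒m≤o∸n 4 (ℕ.*-monoʳ-≤ 2 3≤n)
  odd-order : FinAbGroup.order H ≡ suc (2 * (n * n))
  odd-order = ≡.trans ord (≡.trans (ℕ.+-comm _ 1) (≡.cong suc (ℕ.*-assoc 2 n n)))
  orbit : ∀ k → ev (X ^χ (2 ^ k)) (FinAbGroup.⟦_⟧ H T) ≈ ℤ→R R (y m k)
  orbit = evalχ-2^k-orbit H R domain (n * n) odd-order {FinAbGroup.⟦_⟧ H T} {+ 2} T²≐ X χg≉1 χ[T]≈0
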